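{- Let $r,q$ be integers greater than $1$ and let $P=\{1,\dots,rq\}$ be partitioned into $r$ groups $G_1,\dots,G_r$ of size $q$. For each $j$, let $\mathcal{P}_j$ be the family of all $(q-1)$-element subsets of $G_j$ (so $|\mathcal{P}_j|=q$), and list its members as $P_{j1},\dots,P_{jq}$ in any order. Put $B_i=P_{1i}\cup\cdots\cup P_{ri}$ for $i=1,\dots,q$. For each $g\in P$, with $g\in G_h$, define $B_{g,j}=(G_h\setminus\{g\})\cup(B_j\setminus P_{hj})$ for $j=1,\dots,q$, and $\mathcal{B}_g=\{B_{g,1},\dots,B_{g,q}\}$. Let $D$ be the directed graph with vertex set $\{(g,B): g\in P,\ B\in\mathcal{B}_g\}$ and an arc $(g,B)\to(g',B')$ if and only if $g\in B'$. Then $D$ is a directed strongly regular graph with parameters \[(v,k,t,\lambda,\mu)=\big(rq^2,\ rq(q-1),\ (q-1)(rq-r+1),\ r(q-1)^2-1,\ (q-1)(rq-r+1)\big).\]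
   Context: A directed strongly regular graph with parameters $(v,k,t,\lambda,\mu)$ is a loopless directed graph on $v$ vertices with adjacency matrix $A$ satisfying $AJ=JA=kJ$ and $A^2=tI+\lambda A+\mu(J-I-A)$, where $I$ is the identity and $J$ the all-ones matrix. Equivalently: every vertex has in- and out-degree $k$; every vertex $x$ has exactly $t$ out-neighbours that are also in-neighbours of $x$; and for distinct vertices $x,y$ the number of directed paths of length two from $x$ to $y$ is $\lambda$ if $x\to y$ is an arc and $\mu$ otherwise. -}

module Defs where

open import Data.Nat using (ℕ; zero; suc; _+_; _*_; _∸_)
open import Data.Bool using (Bool; true; false; if_then_else_; T)
open import Data.Fin using (Fin; zero; suc; _≟_)
open import Data.Fin.Properties using (any?)
open import Data.Fin.Subset using (Subset; _∈_; _∪_; _─_; _-_; ⋃)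
open import Data.Fin.Subset.Properties using (_∈?_)
open import Data.Vec using (tabulate)
open import Data.Vec.Properties using (≡-dec)
import Data.Bool.Properties as BoolP
open import Data.List using (map)
open import Data.List.Base using ()
open import Data.Fin using (Fin)
import Data.List as L
import Data.Fin as F
open import Data.Sum using (_⊎_)
open import Data.Product using (Σ; _×_; _,_; proj₁; proj₂)
open import Function.Bundles using (_↔_; Inverse)
open import Relation.Binary.PropositionalEquality using (_≡_)
open import Relation.Nullary.Decidable using (⌊_⌋; True)

Matrix : ℕ → Set
Matrix v = Fin v → Fin v → ℕ

∑ : ∀ {v} → (Fin v → ℕ) → ℕ
∑ {zero}  f = 0
∑ {suc v} f = f zero + ∑ (λ i → f (suc i))

_⊗_ : ∀ {v} → Matrix v → Matrix v → Matrix v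
(A ⊗ B) i j = ∑ (λ l → A i l * B l j)

I : ∀ {v} → Matrix v
I i j = if ⌊ i ≟ j ⌋ then 1 else 0

J : ∀ {v} → Matrix v
J i j = 1

-- A is the adjacency matrix (0/1) of a loopless digraph satisfying
-- AJ = JA = kJ and A² = tI + λA + μ(J − I − A)   (entrywise identities in ℕ;
-- J − I − A has entries in {0,1} because A is a loopless 0/1 matrix).
record IsDSRGMatrix (v : ℕ) (A : Matrix v) (k t λ' μ : ℕ) : Set where
  field
    zero-one  : ∀ i j → (A i j ≡ 0) ⊎ (A i j ≡ 1)
    loopless  : ∀ i → A i i ≡ 0
    AJ≡kJ     : ∀ i j → (A ⊗ J) i j ≡ k * J i j
    JA≡kJ     : ∀ i j → (J ⊗ A) i j ≡ k * J i j
    A²-eq     : ∀ i j → (A ⊗ A) i j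
                  ≡ t * I i j + λ' * A i j + μ * ((J i j ∸ I i j) ∸ A i j)

adjMatrix : ∀ {V : Set} {v} → (V → V → Bool) → (Fin v ↔ V) → Matrix v
adjMatrix arc f i j = if arc (Inverse.to f i) (Inverse.to f j) then 1 else 0

IsDSRG : (V : Set) → (V → V → Bool) → ℕ → ℕ → ℕ → ℕ → ℕ → Set
IsDSRG V arc v k t λ' μ =
  Σ (Fin v ↔ V) λ f → IsDSRGMatrix v (adjMatrix arc f) k t λ' μ

-- A partition of P into r groups of size q, together with an ordering
-- of each family 𝒫_j of (q−1)-subsets of G_j, is encoded by a bijection
-- e : P ↔ Fin r × Fin q :  G_h = { x | proj₁ (e x) = h } and
-- P_{h i} = G_h ∖ { e⁻¹ (h , i) }.

module Construction (r q : ℕ) (e : Fin (r * q) ↔ (Fin r × Fin q)) where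

  n : ℕ
  n = r * q

  grp : Fin n → Fin r
  grp x = proj₁ (Inverse.to e x)

  G : Fin r → Subset n
  G h = tabulate (λ x → ⌊ grp x ≟ h ⌋)

  𝒫 : Fin r → Fin q → Subset n
  𝒫 h i = G h - Inverse.from e (h , i)

  B : Fin q → Subset n
  B i = ⋃ (L.map (λ h → 𝒫 h i) (L.allFin r))

  Bg : Fin n → Fin q → Subset n
  Bg g j = (G (grp g) - g) ∪ (B j ─ 𝒫 (grp g) j)

  -- B ∈ 𝓑_g  (decidable, so the proof component is irrelevant)
  _∈𝓑_ : Subset n → Fin n → Set
  S ∈𝓑 g = True (any? (λ j → ≡-dec BoolP._≟_ S (Bg g j)))

  Vertex : Set
  Vertex = Σ (Fin n) λ g → Σ (Subset n) λ S → S ∈𝓑 g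

  arc : Vertex → Vertex → Bool
  arc (g , _ , _) (g' , S' , _) = ⌊ g ∈? S' ⌋

module Submission where

-- Through the bijection e a point is a cell (h, c) of
-- Fin r × Fin q (group h, column c), and P_{h j} is G_h without the point in
-- column j.  Hence x ∈ B_j iff the column of x is not j, and x ∈ B_{g,j} iff
-- x ≠ g when x is in the group of g, resp. col x ≠ j otherwise.  For r ≥ 2 the
-- blocks B_{g,1}, …, B_{g,q} are distinct, so the vertices of D are the triples
-- (h, c, j), and (h,c,j) → (h′,c′,j′) is an arc iff c ≠ c′ (if h = h′) resp.
-- c ≠ j′ (if h ≠ h′).  For this model digraph on triples the DSRG conditions
-- are counting identities: in- and out-degrees are r·q·(q − 1), and the 2-paths
-- x → z number q·|Fin q ∖ {c, d}| + (r − 1)(q − 1)² for a column d determined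
-- by z, which is λ if x → z and μ = t otherwise.

open import Defs
open import Data.Nat using (ℕ; _≤_; _*_; _∸_; _+_)
open import Data.Fin using (Fin)
open import Data.Product using (_×_)
open import Function.Bundles using (_↔_)

open import Data.Nat using (zero; suc; s≤s; z≤n)
open import Data.Nat.Properties
  using (+-assoc; +-comm; +-identityʳ; *-identityˡ; *-identityʳ; *-zeroʳ; *-assoc; *-suc;
         m+n∸m≡n; m+n∸n≡m; +-cancelʳ-≡; ≤-trans; +-*-semiring)
open import Data.Nat.Solver using (module +-*-Solver)
open import Data.Bool using (Bool; true; false; if_then_else_; not; _∧_; _∨_)
open import Data.Bool.Properties using (T-irrelevant; not-injective; ∧-inverseʳ; ∧-identityʳ; ∧-zeroʳ; ∨-identityʳ)
open import Data.Fin using (zero; suc; _≟_; combine; _↑ˡ_; _↑ʳ_)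
open import Data.Fin.Properties using (*↔×; suc-injective)
open import Data.Fin.Subset using (Subset; _∪_; _─_; _-_; ⁅_⁆; ⋃; inside; outside)
open import Data.Fin.Subset.Properties using (_∈?_)
open import Data.Vec using (_∷_; lookup)
open import Data.Vec.Properties using (lookup∘tabulate; lookup-zipWith; lookup-replicate)
import Data.List as List
open import Data.List.Properties using (map-tabulate)
open import Data.Product using (∃; _,_; proj₁; proj₂)
open import Data.Product.Function.NonDependent.Propositional using (_×-↔_)
open import Data.Sum using (_⊎_; inj₁; inj₂)
import Data.Sum as Sum
open import Function.Bundles using (Inverse; mk↔ₛ′; mk⇔)
open import Function.Construct.Composition using (_↔-∘_)
open import Function.Construct.Identity using (↔-id)
open import Algebra.Properties.Semiring.Sum +-*-semiring
  using (sum; sum-cong-≗; *-distribˡ-sum; *-distribʳ-sum)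
open import Relation.Binary.PropositionalEquality
  using (_≡_; _≢_; refl; sym; trans; cong; cong₂; module ≡-Reasoning)
open import Relation.Nullary using (Dec; yes; no)
open import Relation.Nullary.Decidable using (⌊_⌋; does; dec-true; dec-false; does-⇔; toWitness; fromWitness; ⌊⌋-map′; isYes≗does)

open ≡-Reasoning

-- Finite sums

∑≡sum : ∀ {n} (f : Fin n → ℕ) → ∑ f ≡ sum f
∑≡sum {zero}  f = refl
∑≡sum {suc n} f = cong (f zero +_) (∑≡sum (λ i → f (suc i)))

sum-const : ∀ n a → sum {n} (λ _ → a) ≡ n * a
sum-const zero    a = refl
sum-const (suc n) a = cong (a +_) (sum-const n a)

sum-*ˡ : ∀ {n} a (f : Fin n → ℕ) → sum (λ x → a * f x) ≡ a * sum f
sum-*ˡ a f = sym (*-distribˡ-sum a f)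

sum²-outer : ∀ {m n} (f : Fin m → ℕ) →
  sum (λ x → sum {n} (λ _ → f x)) ≡ n * sum f
sum²-outer {n = n} f = trans (sum-cong-≗ (λ x → sum-const n (f x))) (sum-*ˡ n f)

sum²-product : ∀ {m n} (f : Fin n → ℕ) (g : Fin m → ℕ) →
  sum (λ x → sum (λ y → f y * g x)) ≡ sum f * sum g
sum²-product f g = begin
  sum (λ x → sum (λ y → f y * g x)) ≡⟨ sum-cong-≗ (λ x → sym (*-distribʳ-sum (g x) f)) ⟩
  sum (λ x → sum f * g x)           ≡⟨ sum-*ˡ (sum f) g ⟩
  sum f * sum g                     ∎

sum-update : ∀ {n} (a : Fin n) u (w : Fin n → ℕ) →
  sum (λ x → if does (a ≟ x) then u else w x) + w a ≡ u + sum w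
sum-update {suc n} zero u w = begin
  u + sum (λ x → w (suc x)) + w zero   ≡⟨ +-assoc u _ (w zero) ⟩
  u + (sum (λ x → w (suc x)) + w zero) ≡⟨ cong (u +_) (+-comm _ (w zero)) ⟩
  u + sum w                            ∎
sum-update {suc n} (suc a) u w = begin
  w zero + s + w (suc a)               ≡⟨ +-assoc (w zero) s _ ⟩
  w zero + (s + w (suc a))             ≡⟨ cong (w zero +_) (sum-update a u (λ x → w (suc x))) ⟩
  w zero + (u + sum (λ x → w (suc x))) ≡⟨ sym (+-assoc (w zero) u _) ⟩
  w zero + u + sum (λ x → w (suc x))   ≡⟨ cong (_+ sum (λ x → w (suc x))) (+-comm (w zero) u) ⟩
  u + w zero + sum (λ x → w (suc x))   ≡⟨ +-assoc u (w zero) _ ⟩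
  u + sum w                            ∎
  where
  s : ℕ
  s = sum (λ x → if does (a ≟ x) then u else w (suc x))

sum-↑ : ∀ m n (f : Fin (m + n) → ℕ) →
  sum f ≡ sum (λ i → f (i ↑ˡ n)) + sum (λ j → f (m ↑ʳ j))
sum-↑ zero    n f = refl
sum-↑ (suc m) n f = trans (cong (f zero +_) (sum-↑ m n (λ i → f (suc i))))
                          (sym (+-assoc (f zero) _ _))

sum-combine : ∀ m n (f : Fin (m * n) → ℕ) →
  sum f ≡ sum (λ (i : Fin m) → sum (λ (j : Fin n) → f (combine i j)))
sum-combine zero    n f = refl
sum-combine (suc m) n f = trans (sum-↑ n (m * n) f)
  (cong (sum (λ j → f (j ↑ˡ (m * n))) +_) (sum-combine m n (λ k → f (n ↑ʳ k))))

-- Counting with the inequality indicator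

differ : ∀ {n} → Fin n → Fin n → ℕ
differ a b = if does (a ≟ b) then 0 else 1

differ-sym : ∀ {n} (a b : Fin n) → differ a b ≡ differ b a
differ-sym a b = cong (λ s → if s then 0 else 1) (does-⇔ (mk⇔ sym sym) (a ≟ b) (b ≟ a))

differ-0-1 : ∀ {n} (a b : Fin n) → differ a b ≡ 0 ⊎ differ a b ≡ 1
differ-0-1 a b with does (a ≟ b)
... | true  = inj₁ refl
... | false = inj₂ refl

differ-refl : ∀ {n} (a : Fin n) → differ a a ≡ 0
differ-refl a = cong (λ s → if s then 0 else 1) (dec-true (a ≟ a) refl)

sum-differʳ : ∀ {n} (a : Fin n) → sum (differ a) ≡ n ∸ 1
sum-differʳ {n} a = begin
  sum (differ a)                ≡⟨ sym (m+n∸n≡m (sum (differ a)) 1) ⟩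
  sum (differ a) + 1 ∸ 1        ≡⟨ cong (_∸ 1) (sum-update a 0 (λ _ → 1)) ⟩
  sum {n} (λ _ → 1) ∸ 1         ≡⟨ cong (_∸ 1) (trans (sum-const n 1) (*-identityʳ n)) ⟩
  n ∸ 1                         ∎

sum-differˡ : ∀ {n} (a : Fin n) → sum (λ x → differ x a) ≡ n ∸ 1
sum-differˡ a = trans (sum-cong-≗ (λ x → differ-sym x a)) (sum-differʳ a)

avoid : ∀ {n} → Fin n → Fin n → ℕ
avoid a b = sum (λ x → differ a x * differ x b)

avoid+differ : ∀ {n} (a b : Fin n) → avoid a b + differ a b ≡ n ∸ 1
avoid+differ {n} a b = begin
  avoid a b + differ a b                                        ≡⟨ cong (_+ differ a b) (sum-cong-≗ summand) ⟩
  sum (λ x → if does (a ≟ x) then 0 else differ x b) + differ a b ≡⟨ sum-update a 0 (λ x → differ x b) ⟩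
  sum (λ x → differ x b)                                        ≡⟨ sum-differˡ b ⟩
  n ∸ 1                                                         ∎
  where
  summand : ∀ x → (if does (a ≟ x) then 0 else 1) * differ x b ≡ (if does (a ≟ x) then 0 else differ x b)
  summand x with does (a ≟ x)
  ... | true  = refl
  ... | false = +-identityʳ (differ x b)

-- The model digraph

module Model (r q : ℕ) where

  -- (h, c, j) stands for the vertex (g, B_{g,j}), g the point in cell (h, c)
  Triple : Set
  Triple = Fin r × Fin q × Fin q

  sumTriple : (Triple → ℕ) → ℕ
  sumTriple F = sum λ h → sum λ c → sum λ j → F (h , c , j)

  sumTriple-cong : ∀ {F G : Triple → ℕ} → (∀ y → F y ≡ G y) → sumTriple F ≡ sumTriple G
  sumTriple-cong F≗G = sum-cong-≗ λ h → sum-cong-≗ λ c → sum-cong-≗ λ j → F≗G (h , c , j)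

  -- a point of group h lies in the block B′ of z = (h′, c′, j′) iff its
  -- column differs from target h z
  target : Fin r → Triple → Fin q
  target h (h′ , c′ , j′) = if does (h ≟ h′) then c′ else j′

  adj : Triple → Triple → ℕ
  adj (h , c , _) z = differ c (target h z)

  adj-0-1 : ∀ x z → adj x z ≡ 0 ⊎ adj x z ≡ 1
  adj-0-1 (h , c , _) z = differ-0-1 c (target h z)

  adj-loopless : ∀ x → adj x x ≡ 0
  adj-loopless (h , c , j) =
    trans (cong (λ s → differ c (if s then c else j)) (dec-true (h ≟ h) refl)) (differ-refl c)

  -- Each group h′ contributes q·(q − 1) out-neighbours: inside the group of x the
  -- column c′ must avoid c (any j′), elsewhere the index j′ must avoid c (any c′).
  out-degree : ∀ x → sumTriple (adj x) ≡ r * q * (q ∸ 1)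
  out-degree (h , c , _) = begin
    sum (λ h′ → sum (λ c′ → sum (λ j′ → differ c (target h (h′ , c′ , j′)))))
      ≡⟨ sum-cong-≗ plane ⟩
    sum {r} (λ _ → q * (q ∸ 1))  ≡⟨ sum-const r _ ⟩
    r * (q * (q ∸ 1))            ≡⟨ sym (*-assoc r q _) ⟩
    r * q * (q ∸ 1)              ∎
    where
    plane : ∀ h′ → sum (λ c′ → sum (λ j′ → differ c (if does (h ≟ h′) then c′ else j′)))
                   ≡ q * (q ∸ 1)
    plane h′ with does (h ≟ h′)
    ... | true  = trans (sum²-outer {n = q} (differ c)) (cong (q *_) (sum-differʳ c))
    ... | false = trans (sum-const q _) (cong (q *_) (sum-differʳ c))

  -- For fixed z and group h the condition c ≠ target h z leaves q − 1 columns c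
  -- and all q indices j, so the in-degree is r·q·(q − 1) as well.
  in-degree : ∀ z → sumTriple (λ y → adj y z) ≡ r * q * (q ∸ 1)
  in-degree z = begin
    sum (λ h → sum (λ c → sum {q} (λ _ → differ c (target h z))))  ≡⟨ sum-cong-≗ plane ⟩
    sum {r} (λ _ → q * (q ∸ 1))                                  ≡⟨ sum-const r _ ⟩
    r * (q * (q ∸ 1))                                            ≡⟨ sym (*-assoc r q _) ⟩
    r * q * (q ∸ 1)                                              ∎
    where
    plane : ∀ (h : Fin r) → sum (λ (c : Fin q) → sum {q} (λ _ → differ c (target h z))) ≡ q * (q ∸ 1)
    plane h = trans (sum²-outer {n = q} (λ c → differ c (target h z)))
                    (cong (q *_) (sum-differˡ (target h z)))

  W : ℕ
  W = (q ∸ 1) * (q ∸ 1)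

  -- Paths x → y → z of length two: q·|Fin q ∖ {c, target h z}| of them run
  -- through the group h of x, and (q − 1)² = W through each of the r − 1 others.
  two-paths : ∀ h c j z →
    sumTriple (λ y → adj (h , c , j) y * adj y z) + W ≡ q * avoid c (target h z) + r * W
  two-paths h c j z = begin
    sum plane + W                                        ≡⟨ cong (_+ W) (sum-cong-≗ plane-size) ⟩
    sum (λ h′ → if does (h ≟ h′) then q * N else W) + W ≡⟨ sum-update h (q * N) (λ _ → W) ⟩
    q * N + sum {r} (λ _ → W)                            ≡⟨ cong (q * N +_) (sum-const r W) ⟩
    q * N + r * W                                        ∎
    where
    N : ℕ
    N = avoid c (target h z)
    plane : Fin r → ℕ
    plane h′ = sum (λ c′ → sum (λ j′ → adj (h , c , j) (h′ , c′ , j′) * adj (h′ , c′ , j′) z))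
    plane-size : ∀ h′ → sum (λ c′ → sum (λ j′ → differ c (if does (h ≟ h′) then c′ else j′)
                                                   * differ c′ (target h′ z)))
                        ≡ (if does (h ≟ h′) then q * N else W)
    plane-size h′ with h ≟ h′
    ... | yes refl = sum²-outer {n = q} (λ c′ → differ c c′ * differ c′ (target h z))
    ... | no _     = trans (sum²-product (differ c) (λ c′ → differ c′ (target h′ z)))
                           (cong₂ _*_ (sum-differʳ c) (sum-differˡ (target h′ z)))

-- Arithmetic of the parameters

module Parameters (s p : ℕ) where

  open +-*-Solver using (solve; _:+_; _:*_; _:=_; con)

  r q X lam μ : ℕ
  r   = suc s
  q   = suc (suc p)
  X   = suc p * suc p
  lam = r * X ∸ 1
  μ   = suc p * (r * q ∸ r + 1)

  μ-eq : μ + X ≡ q * suc p + r * X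
  μ-eq = begin
    suc p * (r * q ∸ r + 1) + X
      ≡⟨ cong (λ m → suc p * (m + 1) + X) (trans (cong (_∸ r) (*-suc r (suc p))) (m+n∸m≡n r _)) ⟩
    suc p * (r * suc p + 1) + X
      ≡⟨ solve 2 (λ s p → (con 1 :+ p) :* ((con 1 :+ s) :* (con 1 :+ p) :+ con 1) :+ (con 1 :+ p) :* (con 1 :+ p)
                       := (con 2 :+ p) :* (con 1 :+ p) :+ (con 1 :+ s) :* ((con 1 :+ p) :* (con 1 :+ p))) refl s p ⟩
    q * suc p + r * X
      ∎

  -- r·X − 1 unfolds definitionally to  p + p·(p + 1) + s·X
  lam-eq : lam + X ≡ q * p + r * X
  lam-eq = solve 2 (λ s p → p :+ p :* (con 1 :+ p) :+ s :* ((con 1 :+ p) :* (con 1 :+ p)) :+ (con 1 :+ p) :* (con 1 :+ p)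
                          := (con 2 :+ p) :* p :+ (con 1 :+ s) :* ((con 1 :+ p) :* (con 1 :+ p))) refl s p

paths-value : ∀ r q → 1 ≤ r → 2 ≤ q → ∀ S N a → (a ≡ 0 ⊎ a ≡ 1) →
  S + (q ∸ 1) * (q ∸ 1) ≡ q * N + r * ((q ∸ 1) * (q ∸ 1)) → N + a ≡ q ∸ 1 →
  S ≡ (r * ((q ∸ 1) * (q ∸ 1)) ∸ 1) * a + (q ∸ 1) * (r * q ∸ r + 1) * (1 ∸ a)
paths-value (suc s) (suc (suc p)) (s≤s z≤n) (s≤s (s≤s z≤n)) S N .0 (inj₁ refl) paths N+0 = begin
  S                  ≡⟨ +-cancelʳ-≡ X S μ (trans paths (trans (cong (λ n → q * n + r * X) N≡) (sym μ-eq))) ⟩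
  μ                  ≡⟨ sym (cong₂ _+_ (*-zeroʳ lam) (*-identityʳ μ)) ⟩
  lam * 0 + μ * 1    ∎
  where
  open Parameters s p
  N≡ : N ≡ suc p
  N≡ = trans (sym (+-identityʳ N)) N+0
paths-value (suc s) (suc (suc p)) (s≤s z≤n) (s≤s (s≤s z≤n)) S N .1 (inj₂ refl) paths N+1 = begin
  S                  ≡⟨ +-cancelʳ-≡ X S lam (trans paths (trans (cong (λ n → q * n + r * X) N≡) (sym lam-eq))) ⟩
  lam                ≡⟨ sym (trans (cong₂ _+_ (*-identityʳ lam) (*-zeroʳ μ)) (+-identityʳ lam)) ⟩
  lam * 1 + μ * 0    ∎
  where
  open Parameters s p
  N≡ : N ≡ p
  N≡ = +-cancelʳ-≡ 1 N p (trans N+1 (+-comm 1 p))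

-- Since t = μ and there are no loops, the right-hand side of the DSRG
-- equation, t·I + λ·A + μ·(J − I − A), only depends on the arc indicator A.
dsrg-rhs : ∀ lam μ a i → (a ≡ 0 ⊎ a ≡ 1) → (i ≡ 0 ⊎ (i ≡ 1 × a ≡ 0)) →
  lam * a + μ * (1 ∸ a) ≡ μ * i + lam * a + μ * ((1 ∸ i) ∸ a)
dsrg-rhs lam μ .0 .0 (inj₁ refl) (inj₁ refl) rewrite *-zeroʳ μ = refl
dsrg-rhs lam μ .1 .0 (inj₂ refl) (inj₁ refl) rewrite *-zeroʳ μ = refl
dsrg-rhs lam μ .0 .1 _ (inj₂ (refl , refl)) rewrite *-zeroʳ μ | *-zeroʳ lam =
  sym (trans (+-identityʳ (μ * 1 + 0)) (+-identityʳ (μ * 1)))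

-- Subsets as characteristic vectors

∈?-lookup : ∀ {n} (x : Fin n) (p : Subset n) → ⌊ x ∈? p ⌋ ≡ lookup p x
∈?-lookup zero    (inside  ∷ p) = refl
∈?-lookup zero    (outside ∷ p) = refl
∈?-lookup (suc x) (s ∷ p)       = trans (⌊⌋-map′ _ _ (x ∈? p)) (∈?-lookup x p)

lookup-∪ : ∀ {n} (p p′ : Subset n) x → lookup (p ∪ p′) x ≡ lookup p x ∨ lookup p′ x
lookup-∪ p p′ x = lookup-zipWith _∨_ x p p′

lookup-─ : ∀ {n} (p p′ : Subset n) x → lookup (p ─ p′) x ≡ lookup p x ∧ not (lookup p′ x)
lookup-─ (s ∷ p) (inside  ∷ p′) zero    = sym (∧-zeroʳ s)
lookup-─ (s ∷ p) (outside ∷ p′) zero    = sym (∧-identityʳ s)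
lookup-─ (s ∷ p) (_       ∷ p′) (suc x) = lookup-─ p p′ x

lookup-⁅⁆ : ∀ {n} (y x : Fin n) → lookup ⁅ y ⁆ x ≡ does (x ≟ y)
lookup-⁅⁆ zero    zero    = refl
lookup-⁅⁆ zero    (suc x) = lookup-replicate x false
lookup-⁅⁆ (suc y) zero    = refl
lookup-⁅⁆ (suc y) (suc x) = lookup-⁅⁆ y x

lookup-remove : ∀ {n} (p : Subset n) y x → lookup (p - y) x ≡ lookup p x ∧ not (does (x ≟ y))
lookup-remove p y x = trans (lookup-─ p ⁅ y ⁆ x) (cong (λ b → lookup p x ∧ not b) (lookup-⁅⁆ y x))

lookup-⋃-none : ∀ {n r} (P : Fin r → Subset n) x →
  (∀ h → lookup (P h) x ≡ false) → lookup (⋃ (List.tabulate P)) x ≡ false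
lookup-⋃-none {r = zero}  P x none = lookup-replicate x false
lookup-⋃-none {r = suc r} P x none =
  trans (lookup-∪ (P zero) _ x)
        (cong₂ _∨_ (none zero) (lookup-⋃-none (λ h → P (suc h)) x (λ h → none (suc h))))

lookup-⋃-unique : ∀ {n r} (P : Fin r → Subset n) x (h₀ : Fin r) →
  (∀ h → h ≢ h₀ → lookup (P h) x ≡ false) → lookup (⋃ (List.tabulate P)) x ≡ lookup (P h₀) x
lookup-⋃-unique {r = suc r} P x zero others = begin
  lookup (⋃ (List.tabulate P)) x                                       ≡⟨ lookup-∪ (P zero) _ x ⟩
  lookup (P zero) x ∨ lookup (⋃ (List.tabulate (λ h → P (suc h)))) x
    ≡⟨ cong (lookup (P zero) x ∨_) (lookup-⋃-none (λ h → P (suc h)) x (λ h → others (suc h) λ ())) ⟩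
  lookup (P zero) x ∨ false ≡⟨ ∨-identityʳ _ ⟩
  lookup (P zero) x         ∎
lookup-⋃-unique {r = suc r} P x (suc h₀) others =
  trans (lookup-∪ (P zero) _ x)
    (trans (cong (_∨ lookup (⋃ (List.tabulate (λ h → P (suc h)))) x) (others zero λ ()))
      (lookup-⋃-unique (λ h → P (suc h)) x h₀ (λ h h≢h₀ → others (suc h) (λ eq → h≢h₀ (suc-injective eq)))))

does-true⇒ : ∀ {A : Set} (a? : Dec A) → does a? ≡ true → A
does-true⇒ (yes a) _ = a

another : ∀ {r} → 2 ≤ r → (h : Fin r) → ∃ λ h′ → h′ ≢ h
another (s≤s (s≤s z≤n)) zero    = suc zero , λ ()
another (s≤s (s≤s z≤n)) (suc h) = zero , λ ()

-- The digraph D is the model digraph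

module Incidence (r q : ℕ) (e : Fin (r * q) ↔ (Fin r × Fin q)) where

  open Construction r q e
  open Model r q
  open Inverse e using ()
    renaming (to to cell; from to point; strictlyInverseˡ to cell-point; strictlyInverseʳ to point-cell)

  col : Fin n → Fin q
  col x = proj₂ (cell x)

  point-injective : ∀ {u v} → point u ≡ point v → u ≡ v
  point-injective {u} {v} eq = trans (sym (cell-point u)) (trans (cong cell eq) (cell-point v))

  point-≟ : ∀ h c c′ → does (point (h , c) ≟ point (h , c′)) ≡ does (c ≟ c′)
  point-≟ h c c′ = does-⇔ (mk⇔ (λ eq → cong proj₂ (point-injective eq)) (cong (λ c → point (h , c))))
                          (point (h , c) ≟ point (h , c′)) (c ≟ c′)

  ≟-point : ∀ x j → does (x ≟ point (grp x , j)) ≡ does (col x ≟ j)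
  ≟-point x j = does-⇔ (mk⇔ (λ eq → cong proj₂ (trans (cong cell eq) (cell-point _)))
                            (λ eq → trans (sym (point-cell x)) (cong (λ c → point (grp x , c)) eq)))
                       (x ≟ point (grp x , j)) (col x ≟ j)

  lookup-G : ∀ h x → lookup (G h) x ≡ does (grp x ≟ h)
  lookup-G h x = trans (lookup∘tabulate (λ y → ⌊ grp y ≟ h ⌋) x) (isYes≗does (grp x ≟ h))

  lookup-𝒫 : ∀ h j x → lookup (𝒫 h j) x ≡ does (grp x ≟ h) ∧ not (does (x ≟ point (h , j)))
  lookup-𝒫 h j x = trans (lookup-remove (G h) _ x) (cong (_∧ not (does (x ≟ point (h , j)))) (lookup-G h x))

  lookup-B : ∀ j x → lookup (B j) x ≡ not (does (col x ≟ j))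
  lookup-B j x = begin
    lookup (⋃ (List.map (λ h → 𝒫 h j) (List.allFin r))) x
      ≡⟨ cong (λ ps → lookup (⋃ ps) x) (map-tabulate (λ h → h) (λ h → 𝒫 h j)) ⟩
    lookup (⋃ (List.tabulate (λ h → 𝒫 h j))) x
      ≡⟨ lookup-⋃-unique (λ h → 𝒫 h j) x (grp x) other-group ⟩
    lookup (𝒫 (grp x) j) x
      ≡⟨ lookup-𝒫 (grp x) j x ⟩
    does (grp x ≟ grp x) ∧ not (does (x ≟ point (grp x , j)))
      ≡⟨ cong₂ (λ a b → a ∧ not b) (dec-true (grp x ≟ grp x) refl) (≟-point x j) ⟩
    not (does (col x ≟ j))
      ∎
    where
    other-group : ∀ h → h ≢ grp x → lookup (𝒫 h j) x ≡ false
    other-group h h≢ = trans (lookup-𝒫 h j x)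
                             (cong (_∧ not (does (x ≟ point (h , j)))) (dec-false (grp x ≟ h) (λ eq → h≢ (sym eq))))

  lookup-Bg : ∀ g j x → lookup (Bg g j) x
    ≡ (if does (grp x ≟ grp g) then not (does (x ≟ g)) else not (does (col x ≟ j)))
  lookup-Bg g j x = begin
    lookup (Bg g j) x
      ≡⟨ lookup-∪ (G (grp g) - g) _ x ⟩
    lookup (G (grp g) - g) x ∨ lookup (B j ─ 𝒫 (grp g) j) x
      ≡⟨ cong₂ _∨_ (trans (lookup-remove (G (grp g)) g x) (cong (_∧ not (does (x ≟ g))) (lookup-G (grp g) x)))
                   (trans (lookup-─ (B j) _ x) (cong₂ (λ a b → a ∧ not b) (lookup-B j x) (lookup-𝒫 (grp g) j x))) ⟩
    (does same ∧ not (does (x ≟ g))) ∨ (not d ∧ not (does same ∧ not (does (x ≟ point (grp g , j)))))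
      ≡⟨ by-group same ⟩
    (if does same then not (does (x ≟ g)) else not d)
      ∎
    where
    same : Dec (grp x ≡ grp g)
    same = grp x ≟ grp g
    d : Bool
    d = does (col x ≟ j)
    by-group : (s : Dec (grp x ≡ grp g)) →
      (does s ∧ not (does (x ≟ g))) ∨ (not d ∧ not (does s ∧ not (does (x ≟ point (grp g , j)))))
      ≡ (if does s then not (does (x ≟ g)) else not d)
    by-group (yes p) = begin
      not (does (x ≟ g)) ∨ (not d ∧ not (not (does (x ≟ point (grp g , j)))))
        ≡⟨ cong (λ b → not (does (x ≟ g)) ∨ (not d ∧ not (not b)))
                (trans (cong (λ h → does (x ≟ point (h , j))) (sym p)) (≟-point x j)) ⟩
      not (does (x ≟ g)) ∨ (not d ∧ not (not d)) ≡⟨ cong (not (does (x ≟ g)) ∨_) (∧-inverseʳ (not d)) ⟩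
      not (does (x ≟ g)) ∨ false                 ≡⟨ ∨-identityʳ _ ⟩
      not (does (x ≟ g))                         ∎
    by-group (no _) = ∧-identityʳ (not d)

  vert : Triple → Vertex
  vert (h , c , j) = point (h , c) , Bg (point (h , c)) j , fromWitness (j , refl)

  arc-vert : ∀ x z → arc (vert x) (vert z) ≡ not (does (proj₁ (proj₂ x) ≟ target (proj₁ x) z))
  arc-vert (h , c , j) (h′ , c′ , j′) = begin
    ⌊ point (h , c) ∈? Bg (point (h′ , c′)) j′ ⌋
      ≡⟨ ∈?-lookup _ _ ⟩
    lookup (Bg (point (h′ , c′)) j′) (point (h , c))
      ≡⟨ lookup-Bg _ _ _ ⟩
    (if does (grp (point (h , c)) ≟ grp (point (h′ , c′))) then not (does (point (h , c) ≟ point (h′ , c′)))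
     else not (does (col (point (h , c)) ≟ j′)))
      ≡⟨ cong₂ (λ u v → if does (proj₁ u ≟ proj₁ v) then not (does (point (h , c) ≟ point (h′ , c′)))
                        else not (does (proj₂ u ≟ j′)))
               (cell-point (h , c)) (cell-point (h′ , c′)) ⟩
    (if does (h ≟ h′) then not (does (point (h , c) ≟ point (h′ , c′))) else not (does (c ≟ j′)))
      ≡⟨ by-group (h ≟ h′) ⟩
    not (does (c ≟ target h (h′ , c′ , j′)))
      ∎
    where
    by-group : (s : Dec (h ≡ h′)) →
      (if does s then not (does (point (h , c) ≟ point (h′ , c′))) else not (does (c ≟ j′)))
      ≡ not (does (c ≟ (if does s then c′ else j′)))
    by-group (yes refl) = cong not (point-≟ h c c′)
    by-group (no _)     = refl

  arc-indicator : ∀ x z → (if arc (vert x) (vert z) then 1 else 0) ≡ adj x z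
  arc-indicator x@(h , c , _) z = trans (cong (λ b → if b then 1 else 0) (arc-vert x z)) (flip (does (c ≟ target h z)))
    where
    flip : ∀ b → (if not b then 1 else 0) ≡ (if b then 0 else 1)
    flip true  = refl
    flip false = refl

  -- For r ≥ 2 the point in column j of another group lies in B_{g,k} iff k ≠ j;
  -- hence the q blocks B_{g,1}, …, B_{g,q} are distinct.
  Bg-injective : 2 ≤ r → ∀ g {j j′} → Bg g j ≡ Bg g j′ → j ≡ j′
  Bg-injective 2≤r g {j} {j′} eq = does-true⇒ (j ≟ j′) (not-injective (begin
    not (does (j ≟ j′)) ≡⟨ sym (probe j′) ⟩
    lookup (Bg g j′) x  ≡⟨ cong (λ S → lookup S x) (sym eq) ⟩
    lookup (Bg g j) x   ≡⟨ probe j ⟩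
    not (does (j ≟ j))  ≡⟨ cong not (dec-true (j ≟ j) refl) ⟩
    not true            ∎))
    where
    other : ∃ λ h → h ≢ grp g
    other = another 2≤r (grp g)
    h : Fin r
    h = proj₁ other
    x : Fin n
    x = point (h , j)
    probe : ∀ k → lookup (Bg g k) x ≡ not (does (j ≟ k))
    probe k = begin
      lookup (Bg g k) x
        ≡⟨ lookup-Bg g k x ⟩
      (if does (grp x ≟ grp g) then not (does (x ≟ g)) else not (does (col x ≟ k)))
        ≡⟨ cong (λ b → if b then not (does (x ≟ g)) else not (does (col x ≟ k)))
                (dec-false (grp x ≟ grp g) (λ eq → proj₂ other (trans (sym (cong proj₁ (cell-point (h , j)))) eq))) ⟩
      not (does (col x ≟ k))
        ≡⟨ cong (λ c → not (does (c ≟ k))) (cong proj₂ (cell-point (h , j))) ⟩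
      not (does (j ≟ k))
        ∎

  vertex-≡ : ∀ {g g′ S S′} → g ≡ g′ → S ≡ S′ → (p : S ∈𝓑 g) (p′ : S′ ∈𝓑 g′) →
    _≡_ {A = Vertex} (g , S , p) (g′ , S′ , p′)
  vertex-≡ refl refl p p′ = cong (λ p → _ , _ , p) (T-irrelevant p p′)

  vertices : 2 ≤ r → Triple ↔ Vertex
  vertices 2≤r = mk↔ₛ′ vert unvert vert-unvert unvert-vert
    where
    unvert : Vertex → Triple
    unvert (g , S , p) = grp g , col g , proj₁ (toWitness p)
    vert-unvert : ∀ v → vert (unvert v) ≡ v
    vert-unvert (g , S , p) =
      vertex-≡ (point-cell g) (trans (cong (λ g → Bg g j) (point-cell g)) (sym S≡)) _ p
      where
      j : Fin q
      j = proj₁ (toWitness p)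
      S≡ : S ≡ Bg g j
      S≡ = proj₂ (toWitness p)
    unvert-vert : ∀ x → unvert (vert x) ≡ x
    unvert-vert (h , c , j) =
      cong₂ (λ u k → proj₁ u , proj₂ u , k) (cell-point (h , c))
            (sym (Bg-injective 2≤r _ (proj₂ (toWitness p))))
      where
      p : Bg (point (h , c)) j ∈𝓑 point (h , c)
      p = fromWitness (j , refl)

-- Enumerating the triples

module Enumeration (r q : ℕ) where

  open Model r q

  digits : Fin (r * (q * q)) ↔ Triple
  digits = (↔-id (Fin r) ×-↔ *↔×) ↔-∘ *↔×

  open Inverse digits using (to; from; strictlyInverseˡ)

  sum-digits : ∀ F → sum F ≡ sumTriple (λ y → F (from y))
  sum-digits F = trans (sum-combine r (q * q) F)
                       (sum-cong-≗ (λ (h : Fin r) → sum-combine q q (λ k → F (combine h k))))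

  matrix : (Triple → Triple → ℕ) → Matrix (r * (q * q))
  matrix K i l = K (to i) (to l)

  ⊗-matrix : ∀ K L i l → (matrix K ⊗ matrix L) i l ≡ sumTriple (λ y → K (to i) y * L y (to l))
  ⊗-matrix K L i l = begin
    ∑ (λ m → K (to i) (to m) * L (to m) (to l))   ≡⟨ ∑≡sum (λ m → K (to i) (to m) * L (to m) (to l)) ⟩
    sum (λ m → K (to i) (to m) * L (to m) (to l)) ≡⟨ sum-digits _ ⟩
    sumTriple (λ y → K (to i) (to (from y)) * L (to (from y)) (to l))
      ≡⟨ sumTriple-cong (λ y → cong (λ u → K (to i) u * L u (to l)) (strictlyInverseˡ y)) ⟩
    sumTriple (λ y → K (to i) y * L y (to l))     ∎

module DSRG (r q : ℕ) (e : Fin (r * q) ↔ (Fin r × Fin q)) (2≤r : 2 ≤ r) (2≤q : 2 ≤ q) where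

  open Construction r q e using (Vertex; arc)
  open Model r q
  open Incidence r q e
  open Enumeration r q
  open Inverse digits using (to)

  k t lam μ : ℕ
  k   = r * q * (q ∸ 1)
  t   = (q ∸ 1) * (r * q ∸ r + 1)
  lam = r * ((q ∸ 1) * (q ∸ 1)) ∸ 1
  μ   = (q ∸ 1) * (r * q ∸ r + 1)

  enumeration : Fin (r * (q * q)) ↔ Vertex
  enumeration = vertices 2≤r ↔-∘ digits

  arc-kernel : Triple → Triple → ℕ
  arc-kernel x z = if arc (vert x) (vert z) then 1 else 0

  A : Matrix (r * (q * q))
  A = matrix arc-kernel

  A-adj : ∀ i l → A i l ≡ adj (to i) (to l)
  A-adj i l = arc-indicator (to i) (to l)

  zero-one : ∀ i l → A i l ≡ 0 ⊎ A i l ≡ 1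
  zero-one i l = Sum.map (trans (A-adj i l)) (trans (A-adj i l)) (adj-0-1 (to i) (to l))

  loopless : ∀ i → A i i ≡ 0
  loopless i = trans (A-adj i i) (adj-loopless (to i))

  row-sums : ∀ i l → (A ⊗ J) i l ≡ k * J i l
  row-sums i l = begin
    (A ⊗ J) i l                               ≡⟨ ⊗-matrix arc-kernel (λ _ _ → 1) i l ⟩
    sumTriple (λ y → arc-kernel (to i) y * 1)
      ≡⟨ sumTriple-cong (λ y → trans (*-identityʳ (arc-kernel (to i) y)) (arc-indicator (to i) y)) ⟩
    sumTriple (adj (to i))                    ≡⟨ out-degree (to i) ⟩
    k                                         ≡⟨ sym (*-identityʳ k) ⟩
    k * 1                                     ∎

  column-sums : ∀ i l → (J ⊗ A) i l ≡ k * J i l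
  column-sums i l = begin
    (J ⊗ A) i l                               ≡⟨ ⊗-matrix (λ _ _ → 1) arc-kernel i l ⟩
    sumTriple (λ y → 1 * arc-kernel y (to l))
      ≡⟨ sumTriple-cong (λ y → trans (*-identityˡ (arc-kernel y (to l))) (arc-indicator y (to l))) ⟩
    sumTriple (λ y → adj y (to l))            ≡⟨ in-degree (to l) ⟩
    k                                         ≡⟨ sym (*-identityʳ k) ⟩
    k * 1                                     ∎

  identity-entry : ∀ i l → I i l ≡ 0 ⊎ (I i l ≡ 1 × adj (to i) (to l) ≡ 0)
  identity-entry i l = by-equality (i ≟ l)
    where
    by-equality : (d : Dec (i ≡ l)) →
      (if ⌊ d ⌋ then 1 else 0) ≡ 0 ⊎ ((if ⌊ d ⌋ then 1 else 0) ≡ 1 × adj (to i) (to l) ≡ 0)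
    by-equality (yes refl) = inj₂ (refl , adj-loopless (to i))
    by-equality (no _)     = inj₁ refl

  model-two-paths : ∀ x z → sumTriple (λ y → adj x y * adj y z) ≡ lam * adj x z + μ * (1 ∸ adj x z)
  model-two-paths (h , c , j) z =
    paths-value r q (≤-trans (s≤s z≤n) 2≤r) 2≤q _ (avoid c (target h z)) _ (adj-0-1 (h , c , j) z)
                (two-paths h c j z) (avoid+differ c (target h z))

  two-path-counts : ∀ i l → (A ⊗ A) i l ≡ t * I i l + lam * A i l + μ * ((J i l ∸ I i l) ∸ A i l)
  two-path-counts i l = begin
    (A ⊗ A) i l                                       ≡⟨ ⊗-matrix arc-kernel arc-kernel i l ⟩
    sumTriple (λ y → arc-kernel x y * arc-kernel y z)
      ≡⟨ sumTriple-cong (λ y → cong₂ _*_ (arc-indicator x y) (arc-indicator y z)) ⟩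
    sumTriple (λ y → adj x y * adj y z)               ≡⟨ model-two-paths x z ⟩
    lam * a + μ * (1 ∸ a)
      ≡⟨ dsrg-rhs lam μ a (I i l) (adj-0-1 x z) (identity-entry i l) ⟩
    μ * I i l + lam * a + μ * ((1 ∸ I i l) ∸ a)
      ≡⟨ cong (λ b → μ * I i l + lam * b + μ * ((1 ∸ I i l) ∸ b)) (sym (A-adj i l)) ⟩
    t * I i l + lam * A i l + μ * ((J i l ∸ I i l) ∸ A i l) ∎
    where
    x z : Triple
    x = to i
    z = to l
    a : ℕ
    a = adj x z

  isDSRG : IsDSRGMatrix (r * (q * q)) (adjMatrix arc enumeration) k t lam μ
  isDSRG = record
    { zero-one = zero-one ; loopless = loopless ; AJ≡kJ = row-sums ; JA≡kJ = column-sums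
    ; A²-eq = two-path-counts }

mainTheorem4 : (r q : ℕ) → 2 ≤ r → 2 ≤ q → (e : Fin (r * q) ↔ (Fin r × Fin q)) →
    IsDSRG (Construction.Vertex r q e) (Construction.arc r q e)
      (r * (q * q)) (r * q * (q ∸ 1)) ((q ∸ 1) * (r * q ∸ r + 1))
      (r * ((q ∸ 1) * (q ∸ 1)) ∸ 1) ((q ∸ 1) * (r * q ∸ r + 1))
mainTheorem4 r q 2≤r 2≤q e = enumeration , isDSRG
  where open DSRG r q e 2≤r 2≤q
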